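{- Let $m\ge 0$ be an integer, $s$ a parameter, $q$ an indeterminate, and $$l_n(x,m,s,q)=\sum_{k=0}^{\lfloor n/2\rfloor}s^k q^{\binom{k}{2}}\frac{[n]_q!}{[k]_q!\,[n-2k]_q!}\,\frac{1}{\prod_{j=1}^{k}[m+n-j]_q}\,x^{n-2k}.$$ Then for every $n\ge 0$, $$x^n=\sum_{k=0}^{\lfloor n/2\rfloor}(-s)^k\frac{[n]_q!}{[k]_q!\,[n-2k]_q!}\,\frac{[n+m-2k]_q!}{[n+m-k]_q!}\,l_{n-2k}(x,m,s,q).$$ Consequently, if $\Lambda_{m,q}$ is the linear functional on polynomials in $x$ defined by $\Lambda_{m,q}(l_n(x,m,-q^m,q))=[n=0]$, then $\Lambda_{m,q}(x^{2n+1})=0$ and $$\Lambda_{m,q}(x^{2n})=q^{mn}\frac{[2n]_q!\,[m]_q!}{[n]_q!\,[m+n]_q!}\qquad (n\ge0).$$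
   Context: $[n]_q=\frac{1-q^n}{1-q}$, $[n]_q!=[1]_q\cdots[n]_q$, $[0]_q!=1$. Empty products equal $1$. $[n=0]$ is $1$ if $n=0$ and $0$ otherwise. -}

module Defs where

open import Level using (Level; _⊔_) renaming (suc to lsuc)
open import Algebra.Bundles using (CommutativeRing)
open import Relation.Nullary using (¬_)
open import Data.Nat as ℕ using (ℕ; zero; suc; _∸_; ⌊_/2⌋)
open import Data.Nat.Combinatorics using (_C_)

-- The inverse is a total operation whose
-- value at 0 is irrelevant (only x ≉ 0 ⇒ x * x ⁻¹ ≈ 1 is required).
record Field (c ℓ : Level) : Set (lsuc (c ⊔ ℓ)) where
  field
    commutativeRing : CommutativeRing c ℓ
  open CommutativeRing commutativeRing public
  field
    _⁻¹       : Carrier → Carrier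
    ⁻¹-cong   : ∀ {x y} → x ≈ y → x ⁻¹ ≈ y ⁻¹
    ⁻¹-inverse : ∀ x → ¬ (x ≈ 0#) → x * (x ⁻¹) ≈ 1#
    0≉1       : ¬ (0# ≈ 1#)

module FieldOps {c ℓ : Level} (F : Field c ℓ) where
  open Field F public

  _^_ : Carrier → ℕ → Carrier
  x ^ zero  = 1#
  x ^ suc n = x * (x ^ n)

  Σ≤ : ℕ → (ℕ → Carrier) → Carrier
  Σ≤ zero    f = f 0
  Σ≤ (suc N) f = Σ≤ N f + f (suc N)

  Π1 : ℕ → (ℕ → Carrier) → Carrier
  Π1 zero    f = 1#
  Π1 (suc k) f = Π1 k f * f (suc k)

  qint : Carrier → ℕ → Carrier
  qint q zero    = 0#
  qint q (suc n) = qint q n + q ^ n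

  qfact : Carrier → ℕ → Carrier
  qfact q n = Π1 n (qint q)

  iver : ℕ → Carrier
  iver zero    = 1#
  iver (suc _) = 0#

  -- Generic expansion of l_n(x,m,s,q) in the monomial basis, with the
  -- monomial x^i replaced by  mono i :
  --   Σ_{k=0}^{⌊n/2⌋} s^k q^{C(k,2)} [n]!/([k]! [n-2k]!) / Π_{j=1}^k [m+n-j] · mono (n-2k)
  -- With mono i = x ^ i this is the polynomial l_n(x,m,s,q) evaluated at x;
  -- with mono i = Λ(x^i) it is Λ(l_n(x,m,s,q)) for a linear functional Λ.
  lExpand : ℕ → Carrier → Carrier → (ℕ → Carrier) → ℕ → Carrier
  lExpand m s q mono n =
    Σ≤ ⌊ n /2⌋ (λ k →
      (s ^ k) * (q ^ (k C 2))
      * (qfact q n * ((qfact q k * qfact q (n ∸ (k ℕ.+ k))) ⁻¹))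
      * ((Π1 k (λ j → qint q ((m ℕ.+ n) ∸ j))) ⁻¹)
      * mono (n ∸ (k ℕ.+ k)))

  l : ℕ → Carrier → ℕ → Carrier → Carrier → Carrier
  l n x m s q = lExpand m s q (λ i → x ^ i) n

-- Substituting the expansion of l_p into the right-hand side and collecting the coefficient
-- of x^(n-2t) reduces the inversion formula to the orthogonality relation
-- Σ_{k+j=t} d(n,k) c(n-2k,j) = [t=0] between its coefficients d(n,k) and the coefficients
-- c(p,j) of l_p.  For t ≥ 1, once the denominators [e]! [t]! [n+m]! (e = n-2t) are cleared,
-- this says that with M = e + m
--   Σ_{k+j=t} (-1)^k q^C(j,2) [t choose k]_q [M+2j]!/([M+2j-1]⋯[M+j]) · [M+2j+k+1]⋯[M+2t] = 0,
-- and the sum telescopes: by the q-Pascal rule every term is a difference of two values of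
-- an explicit certificate.  The inversion holds with any sequence in place of the monomials;
-- applied to the moments Λ(x^i), for which Λ(l_i) = [i=0], only the term with 2k = n survives.
module Submission where

open import Defs
open import Data.List using ([]; _∷_)
open import Data.Nat using (ℕ; zero; suc; _∸_; ⌊_/2⌋; _≤_; _<_; z≤n; s≤s)
import Data.Nat as ℕ
open import Data.Nat.Combinatorics using (_C_; nCk+nC[k+1]≡[n+1]C[k+1]; nC1≡n)
open import Data.Product using (_×_; _,_)
open import Relation.Nullary using (¬_)
open import Relation.Binary.PropositionalEquality as ≡ using (_≡_; cong)
import Algebra.Solver.Ring.NaturalCoefficients.Default as SemiringSolver

module _ where
  open import Data.Nat using (_+_)
  open import Data.Nat.Properties
    using (+-suc; 0∸n≡0; ∸-+-assoc; m+n∸m≡n; +-mono-≤; ≤-trans; ≤-reflexive;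
           ⌊n/2⌋≤⌈n/2⌉; ⌊n/2⌋+⌈n/2⌉≡n)
  open import Data.Nat.Tactic.RingSolver using (solve)

  ⌊n∸[k+k]/2⌋≡⌊n/2⌋∸k : ∀ n k → ⌊ n ∸ (k + k) /2⌋ ≡ ⌊ n /2⌋ ∸ k
  ⌊n∸[k+k]/2⌋≡⌊n/2⌋∸k n             zero    = ≡.refl
  ⌊n∸[k+k]/2⌋≡⌊n/2⌋∸k zero          (suc k) = ≡.refl
  ⌊n∸[k+k]/2⌋≡⌊n/2⌋∸k (suc zero)    (suc k) = cong ⌊_/2⌋ (0∸n≡0 (k + suc k))
  ⌊n∸[k+k]/2⌋≡⌊n/2⌋∸k (suc (suc n)) (suc k) =
    ≡.trans (cong (λ i → ⌊ suc n ∸ i /2⌋) (+-suc k k)) (⌊n∸[k+k]/2⌋≡⌊n/2⌋∸k n k)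

  k≤⌊n/2⌋⇒k+k≤n : ∀ {n k} → k ≤ ⌊ n /2⌋ → k + k ≤ n
  k≤⌊n/2⌋⇒k+k≤n {n} k≤ =
    ≤-trans (+-mono-≤ k≤ (≤-trans k≤ (⌊n/2⌋≤⌈n/2⌉ n))) (≤-reflexive (⌊n/2⌋+⌈n/2⌉≡n n))

  ∸-[k+k]-∸-[j+j] : ∀ n k j → n ∸ (k + k) ∸ (j + j) ≡ n ∸ ((k + j) + (k + j))
  ∸-[k+k]-∸-[j+j] n k j = ≡.trans (∸-+-assoc n (k + k) (j + j)) (cong (n ∸_) k+k+[j+j]≡[k+j]+[k+j])
    where
    k+k+[j+j]≡[k+j]+[k+j] : k + k + (j + j) ≡ (k + j) + (k + j)
    k+k+[j+j]≡[k+j]+[k+j] = solve (k ∷ j ∷ [])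

  [1+n]C2≡n+nC2 : ∀ n → suc n C 2 ≡ n + n C 2
  [1+n]C2≡n+nC2 n = ≡.trans (≡.sym (nCk+nC[k+1]≡[n+1]C[k+1] n 1)) (cong (_+ n C 2) (nC1≡n n))

  m≡n+o⇒m∸n≡o : ∀ {m} n {o} → m ≡ n + o → m ∸ n ≡ o
  m≡n+o⇒m∸n≡o n {o} ≡.refl = m+n∸m≡n n o

module _ {ℓ₁ ℓ₂} (F : Field ℓ₁ ℓ₂) where
  open FieldOps F
  open import Algebra.Properties.Ring ring using (-1*x≈-x; -‿+-comm; -‿involutive; -0#≈0#)
  import Data.Nat.Properties as ℕₚ
  open import Relation.Binary.Reasoning.Setoid setoid
  open SemiringSolver commutativeSemiring using (solve; _:=_; _:+_; _:*_)
  open import Data.Nat.Tactic.RingSolver using () renaming (solve to ℕ-solve)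

  1≉0 : 1# ≉ 0#
  1≉0 1≈0 = 0≉1 (sym 1≈0)

  *-cancelʳ : ∀ z {x y} → z ≉ 0# → x * z ≈ y * z → x ≈ y
  *-cancelʳ z {x} {y} z≉0 xz≈yz = begin
    x                ≈⟨ *-identityʳ x ⟨
    x * 1#           ≈⟨ *-congˡ (⁻¹-inverse z z≉0) ⟨
    x * (z * z ⁻¹)   ≈⟨ *-assoc x z (z ⁻¹) ⟨
    x * z * z ⁻¹     ≈⟨ *-congʳ xz≈yz ⟩
    y * z * z ⁻¹     ≈⟨ *-assoc y z (z ⁻¹) ⟩
    y * (z * z ⁻¹)   ≈⟨ *-congˡ (⁻¹-inverse z z≉0) ⟩
    y * 1#           ≈⟨ *-identityʳ y ⟩
    y                ∎

  *-≉0 : ∀ {x y} → x ≉ 0# → y ≉ 0# → x * y ≉ 0#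
  *-≉0 {x} {y} x≉0 y≉0 xy≈0 = x≉0 (*-cancelʳ y y≉0 (trans xy≈0 (sym (zeroˡ y))))

  *≉0⇒≉0ʳ : ∀ {x y} → x * y ≉ 0# → y ≉ 0#
  *≉0⇒≉0ʳ {x} xy≉0 y≈0 = xy≉0 (trans (*-congˡ y≈0) (zeroʳ x))

  *-≈1 : ∀ {x y} → x ≈ 1# → y ≈ 1# → x * y ≈ 1#
  *-≈1 x≈1 y≈1 = trans (*-cong x≈1 y≈1) (*-identityˡ 1#)

  ⁻¹-distrib-* : ∀ {x y} → x ≉ 0# → y ≉ 0# → (x * y) ⁻¹ ≈ x ⁻¹ * y ⁻¹
  ⁻¹-distrib-* {x} {y} x≉0 y≉0 = *-cancelʳ (x * y) (*-≉0 x≉0 y≉0) (begin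
    (x * y) ⁻¹ * (x * y)         ≈⟨ *-comm _ _ ⟩
    x * y * (x * y) ⁻¹           ≈⟨ ⁻¹-inverse (x * y) (*-≉0 x≉0 y≉0) ⟩
    1#                           ≈⟨ *-≈1 (⁻¹-inverse x x≉0) (⁻¹-inverse y y≉0) ⟨
    x * x ⁻¹ * (y * y ⁻¹)        ≈⟨ solve 4 (λ a b a′ b′ → a :* a′ :* (b :* b′) := a′ :* b′ :* (a :* b)) refl x y (x ⁻¹) (y ⁻¹) ⟩
    x ⁻¹ * y ⁻¹ * (x * y)        ∎)

  1⁻¹≈1 : 1# ⁻¹ ≈ 1#
  1⁻¹≈1 = trans (sym (*-identityˡ (1# ⁻¹))) (⁻¹-inverse 1# 1≉0)

  ^-homo-* : ∀ x a b → x ^ (a ℕ.+ b) ≈ x ^ a * x ^ b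
  ^-homo-* x zero    b = sym (*-identityˡ (x ^ b))
  ^-homo-* x (suc a) b = trans (*-congˡ (^-homo-* x a b)) (sym (*-assoc x (x ^ a) (x ^ b)))

  ^-congˡ : ∀ n {x y} → x ≈ y → x ^ n ≈ y ^ n
  ^-congˡ zero    x≈y = refl
  ^-congˡ (suc n) x≈y = *-cong x≈y (^-congˡ n x≈y)

  ^-assocʳ : ∀ x a b → (x ^ a) ^ b ≈ x ^ (a ℕ.* b)
  ^-assocʳ x a zero    = reflexive (cong (x ^_) (≡.sym (ℕₚ.*-zeroʳ a)))
  ^-assocʳ x a (suc b) = begin
    x ^ a * (x ^ a) ^ b    ≈⟨ *-congˡ (^-assocʳ x a b) ⟩
    x ^ a * x ^ (a ℕ.* b)  ≈⟨ ^-homo-* x a (a ℕ.* b) ⟨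
    x ^ (a ℕ.+ a ℕ.* b)    ≡⟨ cong (x ^_) (≡.sym (ℕₚ.*-suc a b)) ⟩
    x ^ (a ℕ.* suc b)      ∎

  sgn : ℕ → Carrier
  sgn k = (- 1#) ^ k

  sgn-suc : ∀ k x → sgn (suc k) * x ≈ - (sgn k * x)
  sgn-suc k x = trans (*-assoc (- 1#) (sgn k) x) (-1*x≈-x (sgn k * x))

  -x^k≈sgn*x^k : ∀ x k → (- x) ^ k ≈ sgn k * x ^ k
  -x^k≈sgn*x^k x zero    = sym (*-identityˡ 1#)
  -x^k≈sgn*x^k x (suc k) = begin
    - x * (- x) ^ k             ≈⟨ *-cong (sym (-1*x≈-x x)) (-x^k≈sgn*x^k x k) ⟩
    - 1# * x * (sgn k * x ^ k)  ≈⟨ solve 4 (λ a x σ y → a :* x :* (σ :* y) := a :* σ :* (x :* y)) refl (- 1#) x (sgn k) (x ^ k) ⟩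
    sgn (suc k) * x ^ suc k     ∎

  Π1-cong : ∀ k {f g : ℕ → Carrier} → (∀ i → f i ≈ g i) → Π1 k f ≈ Π1 k g
  Π1-cong zero    f≈g = refl
  Π1-cong (suc k) f≈g = *-cong (Π1-cong k f≈g) (f≈g (suc k))

  Π1-suc : ∀ k f → Π1 (suc k) f ≈ f 1 * Π1 k (λ i → f (suc i))
  Π1-suc zero    f = trans (*-identityˡ (f 1)) (sym (*-identityʳ (f 1)))
  Π1-suc (suc k) f = trans (*-congʳ (Π1-suc k f)) (*-assoc _ _ _)

  Σ≤-cong : ∀ N {f g : ℕ → Carrier} → (∀ k → k ≤ N → f k ≈ g k) → Σ≤ N f ≈ Σ≤ N g
  Σ≤-cong zero    f≈g = f≈g 0 z≤n
  Σ≤-cong (suc N) f≈g = +-cong (Σ≤-cong N (λ k k≤N → f≈g k (ℕₚ.m≤n⇒m≤1+n k≤N))) (f≈g (suc N) ℕₚ.≤-refl)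

  Σ≤-distribˡ : ∀ N x f → x * Σ≤ N f ≈ Σ≤ N (λ k → x * f k)
  Σ≤-distribˡ zero    x f = refl
  Σ≤-distribˡ (suc N) x f = trans (distribˡ x (Σ≤ N f) (f (suc N))) (+-congʳ (Σ≤-distribˡ N x f))

  Σ≤-distribʳ : ∀ N x f → Σ≤ N f * x ≈ Σ≤ N (λ k → f k * x)
  Σ≤-distribʳ N x f = trans (*-comm (Σ≤ N f) x) (trans (Σ≤-distribˡ N x f) (Σ≤-cong N (λ k _ → *-comm x (f k))))

  Σ≤-− : ∀ N f g → Σ≤ N (λ k → f k - g k) ≈ Σ≤ N f - Σ≤ N g
  Σ≤-− zero    f g = refl
  Σ≤-− (suc N) f g = begin
    Σ≤ N (λ k → f k - g k) + (f (suc N) - g (suc N))  ≈⟨ +-congʳ (Σ≤-− N f g) ⟩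
    Σ≤ N f - Σ≤ N g + (f (suc N) - g (suc N))         ≈⟨ solve 4 (λ a b c d → a :+ b :+ (c :+ d) := a :+ c :+ (b :+ d)) refl _ _ _ _ ⟩
    Σ≤ N f + f (suc N) + (- Σ≤ N g + - g (suc N))     ≈⟨ +-congˡ (-‿+-comm (Σ≤ N g) (g (suc N))) ⟩
    Σ≤ (suc N) f - Σ≤ (suc N) g                       ∎

  Σ≤-suc : ∀ N f → Σ≤ (suc N) f ≈ f 0 + Σ≤ N (λ k → f (suc k))
  Σ≤-suc zero    f = refl
  Σ≤-suc (suc N) f = trans (+-congʳ (Σ≤-suc N f)) (+-assoc _ _ _)

  Σ≤-zero : ∀ N f → (∀ k → k ≤ N → f k ≈ 0#) → Σ≤ N f ≈ 0#
  Σ≤-zero N f f≈0 = trans (Σ≤-cong N f≈0) (Σ≤0 N)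
    where
    Σ≤0 : ∀ N → Σ≤ N (λ _ → 0#) ≈ 0#
    Σ≤0 zero    = refl
    Σ≤0 (suc N) = trans (+-congʳ (Σ≤0 N)) (+-identityˡ 0#)

  Σ≤-last : ∀ N f → (∀ k → k < N → f k ≈ 0#) → Σ≤ N f ≈ f N
  Σ≤-last zero    f _   = refl
  Σ≤-last (suc N) f f≈0 = trans (+-congʳ (Σ≤-zero N f (λ k k≤N → f≈0 k (s≤s k≤N)))) (+-identityˡ _)

  Σ≤-iver : ∀ N (f : ℕ → Carrier) → Σ≤ N (λ t → iver t * f t) ≈ f 0
  Σ≤-iver zero    f = *-identityˡ (f 0)
  Σ≤-iver (suc N) f = begin
    Σ≤ (suc N) (λ t → iver t * f t)                ≈⟨ Σ≤-suc N _ ⟩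
    1# * f 0 + Σ≤ N (λ t → 0# * f (suc t))         ≈⟨ +-cong (*-identityˡ (f 0)) (Σ≤-zero N _ (λ t _ → zeroˡ (f (suc t)))) ⟩
    f 0 + 0#                                       ≈⟨ +-identityʳ (f 0) ⟩
    f 0                                            ∎

  Σ≤-triangle : ∀ K (a : ℕ → ℕ → Carrier) →
    Σ≤ K (λ k → Σ≤ (K ∸ k) (a k)) ≈ Σ≤ K (λ t → Σ≤ t (λ k → a k (t ∸ k)))
  Σ≤-triangle zero    a = refl
  Σ≤-triangle (suc K) a = begin
    Σ≤ (suc K) (λ k → Σ≤ (suc K ∸ k) (a k))
      ≈⟨ Σ≤-suc K _ ⟩
    Σ≤ (suc K) (a 0) + Σ≤ K (λ k → Σ≤ (K ∸ k) (a (suc k)))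
      ≈⟨ +-cong (Σ≤-suc K (a 0)) (Σ≤-triangle K (λ k → a (suc k))) ⟩
    a 0 0 + Σ≤ K (λ t → a 0 (suc t)) + Σ≤ K (λ t → Σ≤ t (λ k → a (suc k) (t ∸ k)))
      ≈⟨ +-assoc _ _ _ ⟩
    a 0 0 + (Σ≤ K (λ t → a 0 (suc t)) + Σ≤ K (λ t → Σ≤ t (λ k → a (suc k) (t ∸ k))))
      ≈⟨ +-congˡ (Σ≤-+ K) ⟨
    a 0 0 + Σ≤ K (λ t → a 0 (suc t) + Σ≤ t (λ k → a (suc k) (t ∸ k)))
      ≈⟨ +-congˡ (Σ≤-cong K (λ t _ → Σ≤-suc t (λ k → a k (suc t ∸ k)))) ⟨
    a 0 0 + Σ≤ K (λ t → Σ≤ (suc t) (λ k → a k (suc t ∸ k)))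
      ≈⟨ Σ≤-suc K _ ⟨
    Σ≤ (suc K) (λ t → Σ≤ t (λ k → a k (t ∸ k)))
      ∎
    where
    Σ≤-+ : ∀ N {f g} → Σ≤ N (λ k → f k + g k) ≈ Σ≤ N f + Σ≤ N g
    Σ≤-+ zero    = refl
    Σ≤-+ (suc N) {f} {g} = trans (+-congʳ (Σ≤-+ N))
      (solve 4 (λ a b c d → a :+ b :+ (c :+ d) := a :+ c :+ (b :+ d)) refl (Σ≤ N f) (Σ≤ N g) (f (suc N)) (g (suc N)))

  Σ≤-antidiagonal-telescoping : ∀ (f g : ℕ → ℕ → Carrier) →
    (∀ j → f 0 (suc j) ≈ g 0 j) →
    (∀ k → f (suc k) 0 ≈ - g k 0) →
    (∀ k j → f (suc k) (suc j) ≈ g (suc k) j - g k (suc j)) →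
    ∀ t → Σ≤ (suc t) (λ k → f k (suc t ∸ k)) ≈ 0#
  Σ≤-antidiagonal-telescoping f g f₀ₛ fₛ₀ fₛₛ t = begin
    Σ≤ (suc t) (λ k → f k (suc t ∸ k))
      ≈⟨ Σ≤-cong (suc t) split ⟩
    Σ≤ (suc t) (λ k → gʲ k (suc t ∸ k) - gᵏ k (suc t ∸ k))
      ≈⟨ Σ≤-− (suc t) _ _ ⟩
    Σ≤ (suc t) (λ k → gʲ k (suc t ∸ k)) - Σ≤ (suc t) (λ k → gᵏ k (suc t ∸ k))
      ≈⟨ +-congˡ (-‿cong (trans (Σ≤-suc t _) (+-identityˡ _))) ⟩
    Σ≤ (suc t) (λ k → gʲ k (suc t ∸ k)) - Σ≤ t (λ k → g k (t ∸ k))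
      ≈⟨ +-congʳ (trans (+-cong (Σ≤-cong t gʲ-shift) (reflexive (cong (gʲ (suc t)) (ℕₚ.n∸n≡0 t)))) (+-identityʳ _)) ⟩
    Σ≤ t (λ k → g k (t ∸ k)) - Σ≤ t (λ k → g k (t ∸ k))
      ≈⟨ -‿inverseʳ _ ⟩
    0# ∎
    where
    gʲ gᵏ : ℕ → ℕ → Carrier
    gʲ k zero    = 0#
    gʲ k (suc j) = g k j
    gᵏ zero    j = 0#
    gᵏ (suc k) j = g k j

    split : ∀ k → k ≤ suc t → f k (suc t ∸ k) ≈ gʲ k (suc t ∸ k) - gᵏ k (suc t ∸ k)
    split zero    _ = trans (f₀ₛ t) (sym (trans (+-congˡ -0#≈0#) (+-identityʳ _)))
    split (suc k) _ = splitₛ (t ∸ k)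
      where
      splitₛ : ∀ j → f (suc k) j ≈ gʲ (suc k) j - g k j
      splitₛ zero    = trans (fₛ₀ k) (sym (+-identityˡ _))
      splitₛ (suc j) = fₛₛ k j

    gʲ-shift : ∀ k → k ≤ t → gʲ k (suc t ∸ k) ≈ g k (t ∸ k)
    gʲ-shift k k≤t = reflexive (cong (gʲ k) (ℕₚ.+-∸-assoc 1 k≤t))

  Σ≤-inversion : ∀ (d c : ℕ → ℕ → Carrier) →
    (∀ n t → t ℕ.+ t ≤ n → Σ≤ t (λ k → d n k * c (n ∸ (k ℕ.+ k)) (t ∸ k)) ≈ iver t) →
    ∀ (u : ℕ → Carrier) n →
    u n ≈ Σ≤ ⌊ n /2⌋ (λ k → d n k * Σ≤ ⌊ n ∸ (k ℕ.+ k) /2⌋ (λ j →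
            c (n ∸ (k ℕ.+ k)) j * u (n ∸ (k ℕ.+ k) ∸ (j ℕ.+ j))))
  Σ≤-inversion d c orthogonal u n = sym (begin
    Σ≤ K (λ k → d n k * Σ≤ ⌊ p k /2⌋ (term k))
      ≈⟨ Σ≤-cong K (λ k _ → trans (*-congˡ (reflexive (cong (λ J → Σ≤ J (term k)) (⌊n∸[k+k]/2⌋≡⌊n/2⌋∸k n k))))
                                   (Σ≤-distribˡ (K ∸ k) (d n k) (term k))) ⟩
    Σ≤ K (λ k → Σ≤ (K ∸ k) (λ j → d n k * term k j))
      ≈⟨ Σ≤-triangle K (λ k j → d n k * term k j) ⟩
    Σ≤ K (λ t → Σ≤ t (λ k → d n k * term k (t ∸ k)))
      ≈⟨ Σ≤-cong K (λ t _ → trans (Σ≤-cong t (collect t)) (sym (Σ≤-distribʳ t _ _))) ⟩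
    Σ≤ K (λ t → Σ≤ t (λ k → d n k * c (p k) (t ∸ k)) * u (n ∸ (t ℕ.+ t)))
      ≈⟨ Σ≤-cong K (λ t t≤K → *-congʳ (orthogonal n t (k≤⌊n/2⌋⇒k+k≤n t≤K))) ⟩
    Σ≤ K (λ t → iver t * u (n ∸ (t ℕ.+ t)))
      ≈⟨ Σ≤-iver K _ ⟩
    u n ∎)
    where
    K : ℕ
    K = ⌊ n /2⌋
    p : ℕ → ℕ
    p k = n ∸ (k ℕ.+ k)
    term : ℕ → ℕ → Carrier
    term k j = c (p k) j * u (p k ∸ (j ℕ.+ j))

    collect : ∀ t k → k ≤ t → d n k * term k (t ∸ k) ≈ d n k * c (p k) (t ∸ k) * u (n ∸ (t ℕ.+ t))
    collect t k k≤t = begin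
      d n k * term k (t ∸ k)                                       ≈⟨ *-assoc _ _ _ ⟨
      d n k * c (p k) (t ∸ k) * u (p k ∸ ((t ∸ k) ℕ.+ (t ∸ k)))    ≡⟨ cong (λ i → d n k * c (p k) (t ∸ k) * u i) index ⟩
      d n k * c (p k) (t ∸ k) * u (n ∸ (t ℕ.+ t))                  ∎
      where
      index : p k ∸ ((t ∸ k) ℕ.+ (t ∸ k)) ≡ n ∸ (t ℕ.+ t)
      index = ≡.trans (∸-[k+k]-∸-[j+j] n k (t ∸ k)) (cong (λ i → n ∸ (i ℕ.+ i)) (ℕₚ.m+[n∸m]≡n k≤t))

  *-iver-pos : ∀ {x i j} → i < j → x * iver (j ∸ i) ≈ 0#
  *-iver-pos {x} {i} {j} i<j with j ∸ i | ℕₚ.m<n⇒0<n∸m i<j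
  ... | suc _ | _ = zeroʳ x

  Σ≤-iver-odd : ∀ N (a : ℕ → Carrier) →
    Σ≤ ⌊ suc (N ℕ.+ N) /2⌋ (λ k → a k * iver (suc (N ℕ.+ N) ∸ (k ℕ.+ k))) ≈ 0#
  Σ≤-iver-odd N a = begin
    Σ≤ ⌊ suc (N ℕ.+ N) /2⌋ f  ≡⟨ cong (λ K → Σ≤ K f) (ℕₚ.n≡⌈n+n/2⌉ N) ⟨
    Σ≤ N f                    ≈⟨ Σ≤-zero N f (λ k k≤N → *-iver-pos (s≤s (ℕₚ.+-mono-≤ k≤N k≤N))) ⟩
    0#                        ∎
    where
    f : ℕ → Carrier
    f k = a k * iver (suc (N ℕ.+ N) ∸ (k ℕ.+ k))

  Σ≤-iver-even : ∀ N (a : ℕ → Carrier) →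
    Σ≤ ⌊ N ℕ.+ N /2⌋ (λ k → a k * iver (N ℕ.+ N ∸ (k ℕ.+ k))) ≈ a N
  Σ≤-iver-even N a = begin
    Σ≤ ⌊ N ℕ.+ N /2⌋ f     ≡⟨ cong (λ K → Σ≤ K f) (ℕₚ.n≡⌊n+n/2⌋ N) ⟨
    Σ≤ N f                 ≈⟨ Σ≤-last N f (λ k k<N → *-iver-pos (ℕₚ.+-mono-< k<N k<N)) ⟩
    a N * iver (N ℕ.+ N ∸ (N ℕ.+ N))  ≡⟨ cong (λ i → a N * iver i) (ℕₚ.n∸n≡0 (N ℕ.+ N)) ⟩
    a N * 1#               ≈⟨ *-identityʳ (a N) ⟩
    a N                    ∎
    where
    f : ℕ → Carrier
    f k = a k * iver (N ℕ.+ N ∸ (k ℕ.+ k))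

  -- q-integers, q-factorials and Gaussian binomials

  module _ (q : Carrier) (qint≉0 : ∀ j → qint q (suc j) ≉ 0#) where

    [_] : ℕ → Carrier
    [ n ] = qint q n

    [_]! : ℕ → Carrier
    [ n ]! = qfact q n

    qint-+ : ∀ a b → [ a ℕ.+ b ] ≈ [ a ] + q ^ a * [ b ]
    qint-+ a zero    = begin
      [ a ℕ.+ 0 ]          ≡⟨ cong [_] (ℕₚ.+-identityʳ a) ⟩
      [ a ]                ≈⟨ +-identityʳ [ a ] ⟨
      [ a ] + 0#           ≈⟨ +-congˡ (zeroʳ (q ^ a)) ⟨
      [ a ] + q ^ a * 0#   ∎
    qint-+ a (suc b) = begin
      [ a ℕ.+ suc b ]                          ≡⟨ cong [_] (ℕₚ.+-suc a b) ⟩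
      [ a ℕ.+ b ] + q ^ (a ℕ.+ b)              ≈⟨ +-cong (qint-+ a b) (^-homo-* q a b) ⟩
      [ a ] + q ^ a * [ b ] + q ^ a * q ^ b    ≈⟨ solve 4 (λ x y z w → x :+ y :* z :+ y :* w := x :+ y :* (z :+ w)) refl [ a ] (q ^ a) [ b ] (q ^ b) ⟩
      [ a ] + q ^ a * ([ b ] + q ^ b)          ∎

    qfact≉0 : ∀ n → [ n ]! ≉ 0#
    qfact≉0 zero    = 1≉0
    qfact≉0 (suc n) = *-≉0 (qfact≉0 n) (qint≉0 n)

    rising : ℕ → ℕ → Carrier
    rising b k = Π1 k (λ i → [ b ℕ.+ i ])

    falling : ℕ → ℕ → Carrier
    falling a j = Π1 j (λ i → [ a ∸ i ])

    qfact-+-rising : ∀ b k → [ b ℕ.+ k ]! ≈ [ b ]! * rising b k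
    qfact-+-rising b zero    = trans (reflexive (cong [_]! (ℕₚ.+-identityʳ b))) (sym (*-identityʳ [ b ]!))
    qfact-+-rising b (suc k) = begin
      [ b ℕ.+ suc k ]!                        ≡⟨ cong [_]! (ℕₚ.+-suc b k) ⟩
      [ b ℕ.+ k ]! * [ suc (b ℕ.+ k) ]        ≈⟨ *-cong (qfact-+-rising b k) (reflexive (cong [_] (≡.sym (ℕₚ.+-suc b k)))) ⟩
      [ b ]! * rising b k * [ b ℕ.+ suc k ]   ≈⟨ *-assoc _ _ _ ⟩
      [ b ]! * rising b (suc k)               ∎

    rising-suc : ∀ b k → rising b (suc k) ≈ [ suc b ] * rising (suc b) k
    rising-suc b k = trans (Π1-suc k (λ i → [ b ℕ.+ i ]))
      (*-cong (reflexive (cong [_] (ℕₚ.+-comm b 1))) (Π1-cong k (λ i → reflexive (cong [_] (ℕₚ.+-suc b i)))))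

    qfact-+-falling : ∀ b c → [ b ℕ.+ c ]! ≈ falling (suc (b ℕ.+ c)) b * [ c ]!
    qfact-+-falling zero    c = sym (*-identityˡ [ c ]!)
    qfact-+-falling (suc b) c = begin
      [ b ℕ.+ c ]! * [ suc (b ℕ.+ c) ]                                   ≈⟨ *-congʳ (qfact-+-falling b c) ⟩
      falling (suc (b ℕ.+ c)) b * [ c ]! * [ suc (b ℕ.+ c) ]             ≈⟨ solve 3 (λ x y z → x :* y :* z := z :* x :* y) refl _ _ _ ⟩
      [ suc (b ℕ.+ c) ] * falling (suc (b ℕ.+ c)) b * [ c ]!             ≈⟨ *-congʳ (Π1-suc b (λ i → [ suc (suc b ℕ.+ c) ∸ i ])) ⟨
      falling (suc (suc b ℕ.+ c)) (suc b) * [ c ]!                      ∎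

    cofactor : ℕ → ℕ → Carrier
    cofactor zero    M = [ M ]!
    cofactor (suc j) M = [ suc j ℕ.+ suc j ℕ.+ M ] * [ j ℕ.+ M ]!

    qfact≈cofactor*falling : ∀ j M → [ j ℕ.+ j ℕ.+ M ]! ≈ cofactor j M * falling (j ℕ.+ j ℕ.+ M) j
    qfact≈cofactor*falling zero    M = sym (*-identityʳ [ M ]!)
    qfact≈cofactor*falling (suc j) M = begin
      [ suc j ℕ.+ suc j ℕ.+ M ]!                           ≡⟨ cong [_]! reassoc ⟩
      [ X ]! * [ suc X ]                                   ≈⟨ *-congʳ (qfact-+-falling (suc j) (j ℕ.+ M)) ⟩
      falling (suc X) (suc j) * [ j ℕ.+ M ]! * [ suc X ]   ≈⟨ solve 3 (λ x y z → x :* y :* z := z :* y :* x) refl _ _ _ ⟩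
      [ suc X ] * [ j ℕ.+ M ]! * falling (suc X) (suc j)   ≡⟨ cong (λ i → [ i ] * [ j ℕ.+ M ]! * falling i (suc j)) reassoc ⟨
      cofactor (suc j) M * falling (suc j ℕ.+ suc j ℕ.+ M) (suc j)  ∎
      where
      X : ℕ
      X = suc j ℕ.+ (j ℕ.+ M)
      reassoc : suc j ℕ.+ suc j ℕ.+ M ≡ suc (suc j ℕ.+ (j ℕ.+ M))
      reassoc = ℕ-solve (j ∷ M ∷ [])

    -- qbinom k j is the Gaussian binomial coefficient [k + j choose k]_q.
    qbinom : ℕ → ℕ → Carrier
    qbinom zero    j       = 1#
    qbinom (suc k) zero    = 1#
    qbinom (suc k) (suc j) = qbinom (suc k) j + q ^ suc j * qbinom k (suc j)

    qbinom-qfact : ∀ k j → qbinom k j * [ k ]! * [ j ]! ≈ [ k ℕ.+ j ]!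
    qbinom-qfact zero    j       = trans (*-congʳ (*-identityˡ 1#)) (*-identityˡ [ j ]!)
    qbinom-qfact (suc k) zero    = trans (*-identityʳ _) (trans (*-identityˡ _) (reflexive (cong [_]! (≡.sym (ℕₚ.+-identityʳ (suc k))))))
    qbinom-qfact (suc k) (suc j) = begin
      (X + q ^ suc j * Y) * ([ k ]! * [ suc k ]) * ([ j ]! * [ suc j ])
        ≈⟨ solve 7 (λ x y z k! ck j! cj → (x :+ y :* z) :* (k! :* ck) :* (j! :* cj)
                                          := x :* (k! :* ck) :* j! :* cj :+ y :* ck :* (z :* k! :* (j! :* cj)))
                   refl X (q ^ suc j) Y [ k ]! [ suc k ] [ j ]! [ suc j ] ⟩
      X * [ suc k ]! * [ j ]! * [ suc j ] + q ^ suc j * [ suc k ] * (Y * [ k ]! * [ suc j ]!)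
        ≈⟨ +-cong (*-congʳ (qbinom-qfact (suc k) j)) (*-congˡ (trans (qbinom-qfact k (suc j)) (reflexive (cong [_]! (ℕₚ.+-suc k j))))) ⟩
      [ suc k ℕ.+ j ]! * [ suc j ] + q ^ suc j * [ suc k ] * [ suc k ℕ.+ j ]!
        ≈⟨ solve 4 (λ a b c d → a :* b :+ c :* d :* a := a :* (b :+ c :* d)) refl [ suc k ℕ.+ j ]! [ suc j ] (q ^ suc j) [ suc k ] ⟩
      [ suc k ℕ.+ j ]! * ([ suc j ] + q ^ suc j * [ suc k ])
        ≈⟨ *-congˡ (qint-+ (suc j) (suc k)) ⟨
      [ suc k ℕ.+ j ]! * [ suc j ℕ.+ suc k ]
        ≈⟨ *-cong (reflexive (cong [_]! (≡.sym (ℕₚ.+-suc k j)))) (reflexive (cong [_] (ℕₚ.+-comm (suc j) (suc k)))) ⟩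
      [ suc k ℕ.+ suc j ]! ∎
      where
      X Y : Carrier
      X = qbinom (suc k) j
      Y = qbinom k (suc j)

    qbinom-shift : ∀ k j → qbinom (suc k) j * [ suc k ] ≈ qbinom k (suc j) * [ suc j ]
    qbinom-shift k j = *-cancelʳ ([ k ]! * [ j ]!) (*-≉0 (qfact≉0 k) (qfact≉0 j)) (begin
      qbinom (suc k) j * [ suc k ] * ([ k ]! * [ j ]!)  ≈⟨ solve 4 (λ a b c d → a :* b :* (c :* d) := a :* (c :* b) :* d) refl _ _ _ _ ⟩
      qbinom (suc k) j * [ suc k ]! * [ j ]!            ≈⟨ qbinom-qfact (suc k) j ⟩
      [ suc k ℕ.+ j ]!                                  ≡⟨ cong [_]! (≡.sym (ℕₚ.+-suc k j)) ⟩
      [ k ℕ.+ suc j ]!                                  ≈⟨ qbinom-qfact k (suc j) ⟨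
      qbinom k (suc j) * [ k ]! * ([ j ]! * [ suc j ])  ≈⟨ solve 4 (λ a b c d → a :* b :* (c :* d) := a :* d :* (b :* c)) refl _ _ _ _ ⟩
      qbinom k (suc j) * [ suc j ] * ([ k ]! * [ j ]!)  ∎)

    -- The telescoping identity

    module _ (M : ℕ) where

      -- After the denominators are cleared, the (k, t-k) term of the orthogonality relation
      -- becomes s^t [n]! · orthogonalityTerm (e+m) k (t-k).
      orthogonalityTerm : ℕ → ℕ → Carrier
      orthogonalityTerm k j =
        sgn k * q ^ (j C 2) * (qbinom k j * cofactor j M * rising (j ℕ.+ j ℕ.+ M ℕ.+ k) k)

      certificate : ℕ → ℕ → Carrier
      certificate k j =
        sgn k * q ^ (suc j C 2) * (qbinom k j * [ j ℕ.+ M ]! * rising (suc (j ℕ.+ j ℕ.+ M ℕ.+ k)) (suc k))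

      telescope₀ₛ : ∀ j → orthogonalityTerm 0 (suc j) ≈ certificate 0 j
      telescope₀ₛ j = *-congˡ (begin
        1# * ([ A ] * [ j ℕ.+ M ]!) * 1#          ≈⟨ solve 3 (λ o a f → o :* (a :* f) :* o := o :* f :* (o :* a)) refl 1# [ A ] [ j ℕ.+ M ]! ⟩
        1# * [ j ℕ.+ M ]! * (1# * [ A ])          ≡⟨ cong (λ i → 1# * [ j ℕ.+ M ]! * (1# * [ i ])) index ⟩
        1# * [ j ℕ.+ M ]! * rising (suc (j ℕ.+ j ℕ.+ M ℕ.+ 0)) 1  ∎)
        where
        A : ℕ
        A = suc j ℕ.+ suc j ℕ.+ M
        index : suc j ℕ.+ suc j ℕ.+ M ≡ suc (j ℕ.+ j ℕ.+ M ℕ.+ 0) ℕ.+ 1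
        index = ℕ-solve (j ∷ M ∷ [])

      telescopeₛ₀ : ∀ k → orthogonalityTerm (suc k) 0 ≈ - certificate k 0
      telescopeₛ₀ k = begin
        sgn (suc k) * 1# * Y                ≈⟨ *-assoc _ _ _ ⟩
        sgn (suc k) * (1# * Y)              ≈⟨ sgn-suc k (1# * Y) ⟩
        - (sgn k * (1# * Y))                ≈⟨ -‿cong (*-assoc _ _ _) ⟨
        - (sgn k * 1# * Y)                  ≈⟨ -‿cong (*-congˡ (*-cong (*-congʳ (sym (qbinom-k0 k))) (reflexive (cong (λ i → rising i (suc k)) (ℕₚ.+-suc M k))))) ⟩
        - certificate k 0                   ∎
        where
        Y : Carrier
        Y = 1# * [ M ]! * rising (M ℕ.+ suc k) (suc k)
        qbinom-k0 : ∀ k → qbinom k 0 ≈ 1#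
        qbinom-k0 zero    = refl
        qbinom-k0 (suc k) = refl

      telescopeₛₛ : ∀ k j → orthogonalityTerm (suc k) (suc j) ≈ certificate (suc k) j - certificate k (suc j)
      telescopeₛₛ k j = begin
        orthogonalityTerm (suc k) (suc j)                ≈⟨ *-assoc _ _ _ ⟩
        sgn (suc k) * Eₜ                                 ≈⟨ sgn-suc k Eₜ ⟩
        - (σ * Eₜ)                                       ≈⟨ -‿cong (*-congˡ Eₕ+Eᵤ≈Eₜ) ⟨
        - (σ * (Eₕ + Eᵤ))                                ≈⟨ -‿cong (distribˡ σ Eₕ Eᵤ) ⟩
        - (σ * Eₕ + σ * Eᵤ)                              ≈⟨ -‿+-comm (σ * Eₕ) (σ * Eᵤ) ⟨
        - (σ * Eₕ) - σ * Eᵤ                              ≈⟨ +-cong (sym certificate-left) (-‿cong (sym certificate-below)) ⟩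
        certificate (suc k) j - certificate k (suc j)    ∎
        where
        σ c X Y a b f r Q₁ Q₂ Eₜ Eₕ Eᵤ : Carrier
        A B : ℕ
        σ = sgn k
        c = q ^ (suc j C 2)
        X = qbinom (suc k) j
        Y = qbinom k (suc j)
        A = suc j ℕ.+ suc j ℕ.+ M
        B = A ℕ.+ suc k
        a = [ A ]
        b = [ suc (j ℕ.+ M) ]
        f = [ j ℕ.+ M ]!
        r = rising B (suc k)
        Q₁ = q ^ suc j
        Q₂ = q ^ suc (j ℕ.+ M)
        Eₜ = c * ((X + Q₁ * Y) * (a * f) * r)
        Eₕ = c * (X * f * ((a + Q₁ * Q₂ * [ suc k ]) * r))
        Eᵤ = c * Q₁ * (Y * (f * b) * r)

        a≈b+Q₂[1+j] : a ≈ b + Q₂ * [ suc j ]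
        a≈b+Q₂[1+j] = trans (reflexive (cong [_] A≡)) (qint-+ (suc (j ℕ.+ M)) (suc j))
          where
          A≡ : suc j ℕ.+ suc j ℕ.+ M ≡ suc (j ℕ.+ M) ℕ.+ suc j
          A≡ = ℕ-solve (j ∷ M ∷ [])

        q-pascal : X * (a + Q₁ * Q₂ * [ suc k ]) + Q₁ * Y * b ≈ (X + Q₁ * Y) * a
        q-pascal = begin
          X * (a + Q₁ * Q₂ * [ suc k ]) + Q₁ * Y * b
            ≈⟨ solve 7 (λ X Y a b u Q₁ Q₂ → X :* (a :+ Q₁ :* Q₂ :* u) :+ Q₁ :* Y :* b
                                            := X :* a :+ Q₁ :* Q₂ :* (X :* u) :+ Q₁ :* Y :* b)
                 refl X Y a b [ suc k ] Q₁ Q₂ ⟩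
          X * a + Q₁ * Q₂ * (X * [ suc k ]) + Q₁ * Y * b
            ≈⟨ +-congʳ (+-congˡ (*-congˡ (qbinom-shift k j))) ⟩
          X * a + Q₁ * Q₂ * (Y * [ suc j ]) + Q₁ * Y * b
            ≈⟨ solve 7 (λ X Y a b v Q₁ Q₂ → X :* a :+ Q₁ :* Q₂ :* (Y :* v) :+ Q₁ :* Y :* b
                                            := X :* a :+ Q₁ :* Y :* (b :+ Q₂ :* v))
                 refl X Y a b [ suc j ] Q₁ Q₂ ⟩
          X * a + Q₁ * Y * (b + Q₂ * [ suc j ])
            ≈⟨ +-congˡ (*-congˡ a≈b+Q₂[1+j]) ⟨
          X * a + Q₁ * Y * a
            ≈⟨ distribʳ a X (Q₁ * Y) ⟨
          (X + Q₁ * Y) * a ∎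

        Eₕ+Eᵤ≈Eₜ : Eₕ + Eᵤ ≈ Eₜ
        Eₕ+Eᵤ≈Eₜ = begin
          Eₕ + Eᵤ
            ≈⟨ solve 10 (λ c X Y a b u Q₁ Q₂ r f →
                 c :* (X :* f :* ((a :+ Q₁ :* Q₂ :* u) :* r)) :+ c :* Q₁ :* (Y :* (f :* b) :* r)
                 := c :* f :* r :* (X :* (a :+ Q₁ :* Q₂ :* u) :+ Q₁ :* Y :* b))
                 refl c X Y a b [ suc k ] Q₁ Q₂ r f ⟩
          c * f * r * (X * (a + Q₁ * Q₂ * [ suc k ]) + Q₁ * Y * b)
            ≈⟨ *-congˡ q-pascal ⟩
          c * f * r * ((X + Q₁ * Y) * a)
            ≈⟨ solve 7 (λ c X Y a Q₁ r f → c :* f :* r :* ((X :+ Q₁ :* Y) :* a)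
                                           := c :* ((X :+ Q₁ :* Y) :* (a :* f) :* r))
                 refl c X Y a Q₁ r f ⟩
          Eₜ ∎

        certificate-left : certificate (suc k) j ≈ - (σ * Eₕ)
        certificate-left = begin
          sgn (suc k) * c * (X * f * rising (suc B′) (suc (suc k)))   ≈⟨ *-assoc _ _ _ ⟩
          sgn (suc k) * (c * (X * f * rising (suc B′) (suc (suc k)))) ≈⟨ sgn-suc k _ ⟩
          - (σ * (c * (X * f * rising (suc B′) (suc (suc k)))))       ≈⟨ -‿cong (*-congˡ (*-congˡ (*-congˡ peel))) ⟩
          - (σ * Eₕ)                                                  ∎
          where
          B′ : ℕ
          B′ = j ℕ.+ j ℕ.+ M ℕ.+ suc k
          B≡ : suc (suc (j ℕ.+ j ℕ.+ M ℕ.+ suc k)) ≡ suc j ℕ.+ suc j ℕ.+ M ℕ.+ suc k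
          B≡ = ℕ-solve (j ∷ k ∷ M ∷ [])
          A≡ : suc j ℕ.+ suc j ℕ.+ M ≡ suc j ℕ.+ suc (j ℕ.+ M)
          A≡ = ℕ-solve (j ∷ M ∷ [])
          peel : rising (suc B′) (suc (suc k)) ≈ (a + Q₁ * Q₂ * [ suc k ]) * r
          peel = begin
            rising (suc B′) (suc (suc k))                 ≈⟨ rising-suc (suc B′) (suc k) ⟩
            [ suc (suc B′) ] * rising (suc (suc B′)) (suc k) ≡⟨ cong (λ i → [ i ] * rising i (suc k)) B≡ ⟩
            [ A ℕ.+ suc k ] * r                           ≈⟨ *-congʳ (qint-+ A (suc k)) ⟩
            (a + q ^ A * [ suc k ]) * r                    ≈⟨ *-congʳ (+-congˡ (*-congʳ (trans (reflexive (cong (q ^_) A≡)) (^-homo-* q (suc j) (suc (j ℕ.+ M)))))) ⟩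
            (a + Q₁ * Q₂ * [ suc k ]) * r                  ∎

        certificate-below : certificate k (suc j) ≈ σ * Eᵤ
        certificate-below = trans (*-assoc _ _ _) (*-congˡ (*-cong q-power (*-congˡ rising-index)))
          where
          q-power : q ^ (suc (suc j) C 2) ≈ c * Q₁
          q-power = trans (reflexive (cong (q ^_) ([1+n]C2≡n+nC2 (suc j)))) (trans (^-homo-* q (suc j) (suc j C 2)) (*-comm Q₁ c))
          B≡ : suc (suc j ℕ.+ suc j ℕ.+ M ℕ.+ k) ≡ suc j ℕ.+ suc j ℕ.+ M ℕ.+ suc k
          B≡ = ℕ-solve (j ∷ k ∷ M ∷ [])
          rising-index : rising (suc (suc j ℕ.+ suc j ℕ.+ M ℕ.+ k)) (suc k) ≈ r
          rising-index = reflexive (cong (λ i → rising i (suc k)) B≡)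

      orthogonalityTerm-telescopes : ∀ t → Σ≤ (suc t) (λ k → orthogonalityTerm k (suc t ∸ k)) ≈ 0#
      orthogonalityTerm-telescopes =
        Σ≤-antidiagonal-telescoping orthogonalityTerm certificate telescope₀ₛ telescopeₛ₀ telescopeₛₛ

    -- The inversion formula and the moments of Λ

    module _ (m : ℕ) (s : Carrier) where

      -- The -At forms take the factorial arguments separately, so that each index
      -- can be brought into normal form by a separate equation.
      inverseCoeffAt : (n k p a b : ℕ) → Carrier
      inverseCoeffAt n k p a b = (- s) ^ k * ([ n ]! * ([ k ]! * [ p ]!) ⁻¹) * ([ a ]! * [ b ]! ⁻¹)

      inverseCoeff : ℕ → ℕ → Carrier
      inverseCoeff n k = inverseCoeffAt n k (n ∸ (k ℕ.+ k)) ((n ℕ.+ m) ∸ (k ℕ.+ k)) ((n ℕ.+ m) ∸ k)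

      lCoeffAt : (p j e x : ℕ) → Carrier
      lCoeffAt p j e x = s ^ j * q ^ (j C 2) * ([ p ]! * ([ j ]! * [ e ]!) ⁻¹) * falling x j ⁻¹

      lCoeff : ℕ → ℕ → Carrier
      lCoeff p j = lCoeffAt p j (p ∸ (j ℕ.+ j)) (m ℕ.+ p)

      coefficientProductAt : ∀ n k j e {p a b e′ x} →
        p ≡ j ℕ.+ j ℕ.+ e → a ≡ j ℕ.+ j ℕ.+ (e ℕ.+ m) → b ≡ j ℕ.+ j ℕ.+ (e ℕ.+ m) ℕ.+ k → e′ ≡ e → x ≡ a →
        inverseCoeffAt n k p a b * lCoeffAt p j e′ x * ([ e ]! * [ k ℕ.+ j ]! * [ j ℕ.+ j ℕ.+ (e ℕ.+ m) ℕ.+ k ℕ.+ k ]!)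
          ≈ s ^ (k ℕ.+ j) * [ n ]! * orthogonalityTerm (e ℕ.+ m) k j
      coefficientProductAt n k j e ≡.refl ≡.refl ≡.refl ≡.refl ≡.refl = begin
        inverseCoeffAt n k p A B * lCoeffAt p j e A * ([ e ]! * [ k ℕ.+ j ]! * [ B ℕ.+ k ]!)
          ≈⟨ *-cong (*-congʳ (*-cong (*-congʳ (-x^k≈sgn*x^k s k)) (*-congʳ (qfact≈cofactor*falling j M)))) D≈ ⟩
        sgn k * s ^ k * ([ n ]! * KP ⁻¹) * (Z * Π * [ B ]! ⁻¹) * (s ^ j * c * ([ p ]! * JE ⁻¹) * Π ⁻¹)
          * ([ e ]! * (β * [ k ]! * [ j ]!) * ([ B ]! * r))
          ≈⟨ solve 18 (λ σ sk n! KPi Z Π Bi sj c p! JEi Πi e! β k! j! B! r →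
               σ :* sk :* (n! :* KPi) :* (Z :* Π :* Bi) :* (sj :* c :* (p! :* JEi) :* Πi) :* (e! :* (β :* k! :* j!) :* (B! :* r))
               := sk :* sj :* n! :* (σ :* c :* (β :* Z :* r)) :* (k! :* p! :* KPi :* (j! :* e! :* JEi) :* (B! :* Bi) :* (Π :* Πi)))
               refl (sgn k) (s ^ k) [ n ]! (KP ⁻¹) Z Π ([ B ]! ⁻¹) (s ^ j) c [ p ]! (JE ⁻¹) (Π ⁻¹) [ e ]! β [ k ]! [ j ]! [ B ]! r ⟩
        s ^ k * s ^ j * [ n ]! * orthogonalityTerm M k j * (KP * KP ⁻¹ * (JE * JE ⁻¹) * ([ B ]! * [ B ]! ⁻¹) * (Π * Π ⁻¹))
          ≈⟨ *-congˡ (*-≈1 (*-≈1 (*-≈1 (⁻¹-inverse KP KP≉0) (⁻¹-inverse JE JE≉0)) (⁻¹-inverse [ B ]! (qfact≉0 B))) (⁻¹-inverse Π Π≉0)) ⟩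
        s ^ k * s ^ j * [ n ]! * orthogonalityTerm M k j * 1#
          ≈⟨ *-identityʳ _ ⟩
        s ^ k * s ^ j * [ n ]! * orthogonalityTerm M k j
          ≈⟨ *-congʳ (*-congʳ (^-homo-* s k j)) ⟨
        s ^ (k ℕ.+ j) * [ n ]! * orthogonalityTerm M k j ∎
        where
        M p A B : ℕ
        M = e ℕ.+ m
        p = j ℕ.+ j ℕ.+ e
        A = j ℕ.+ j ℕ.+ M
        B = A ℕ.+ k
        c β Z Π r KP JE : Carrier
        c = q ^ (j C 2)
        β = qbinom k j
        Z = cofactor j M
        Π = falling A j
        r = rising B k
        KP = [ k ]! * [ p ]!
        JE = [ j ]! * [ e ]!
        KP≉0 : KP ≉ 0#
        KP≉0 = *-≉0 (qfact≉0 k) (qfact≉0 p)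
        JE≉0 : JE ≉ 0#
        JE≉0 = *-≉0 (qfact≉0 j) (qfact≉0 e)
        Π≉0 : Π ≉ 0#
        Π≉0 = *≉0⇒≉0ʳ (λ ZΠ≈0 → qfact≉0 A (trans (qfact≈cofactor*falling j M) ZΠ≈0))
        D≈ : [ e ]! * [ k ℕ.+ j ]! * [ B ℕ.+ k ]! ≈ [ e ]! * (β * [ k ]! * [ j ]!) * ([ B ]! * r)
        D≈ = *-cong (*-congˡ (sym (qbinom-qfact k j))) (qfact-+-rising B k)

      coefficientProduct : ∀ {n t} k j e → t ≡ k ℕ.+ j → n ≡ t ℕ.+ t ℕ.+ e →
        inverseCoeff n k * lCoeff (n ∸ (k ℕ.+ k)) j * ([ e ]! * [ t ]! * [ n ℕ.+ m ]!)
          ≈ s ^ t * [ n ]! * orthogonalityTerm (e ℕ.+ m) k j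
      coefficientProduct k j e ≡.refl ≡.refl =
        trans (*-congˡ (*-congˡ (reflexive (cong [_]! n+m≡))))
              (coefficientProductAt ((k ℕ.+ j) ℕ.+ (k ℕ.+ j) ℕ.+ e) k j e n∸2k≡ n+m∸2k≡ n+m∸k≡ n∸2k∸2j≡ m+[n∸2k]≡)
        where
        n∸2k≡ : (k ℕ.+ j) ℕ.+ (k ℕ.+ j) ℕ.+ e ∸ (k ℕ.+ k) ≡ j ℕ.+ j ℕ.+ e
        n∸2k≡ = m≡n+o⇒m∸n≡o (k ℕ.+ k) n≡
          where
          n≡ : (k ℕ.+ j) ℕ.+ (k ℕ.+ j) ℕ.+ e ≡ (k ℕ.+ k) ℕ.+ (j ℕ.+ j ℕ.+ e)
          n≡ = ℕ-solve (k ∷ j ∷ e ∷ [])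
        n+m∸2k≡ : (k ℕ.+ j) ℕ.+ (k ℕ.+ j) ℕ.+ e ℕ.+ m ∸ (k ℕ.+ k) ≡ j ℕ.+ j ℕ.+ (e ℕ.+ m)
        n+m∸2k≡ = m≡n+o⇒m∸n≡o (k ℕ.+ k) n+m≡
          where
          n+m≡ : (k ℕ.+ j) ℕ.+ (k ℕ.+ j) ℕ.+ e ℕ.+ m ≡ (k ℕ.+ k) ℕ.+ (j ℕ.+ j ℕ.+ (e ℕ.+ m))
          n+m≡ = ℕ-solve (k ∷ j ∷ e ∷ m ∷ [])
        n+m∸k≡ : (k ℕ.+ j) ℕ.+ (k ℕ.+ j) ℕ.+ e ℕ.+ m ∸ k ≡ j ℕ.+ j ℕ.+ (e ℕ.+ m) ℕ.+ k
        n+m∸k≡ = m≡n+o⇒m∸n≡o k n+m≡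
          where
          n+m≡ : (k ℕ.+ j) ℕ.+ (k ℕ.+ j) ℕ.+ e ℕ.+ m ≡ k ℕ.+ (j ℕ.+ j ℕ.+ (e ℕ.+ m) ℕ.+ k)
          n+m≡ = ℕ-solve (k ∷ j ∷ e ∷ m ∷ [])
        n∸2k∸2j≡ : (k ℕ.+ j) ℕ.+ (k ℕ.+ j) ℕ.+ e ∸ (k ℕ.+ k) ∸ (j ℕ.+ j) ≡ e
        n∸2k∸2j≡ = ≡.trans (∸-[k+k]-∸-[j+j] _ k j) (ℕₚ.m+n∸m≡n ((k ℕ.+ j) ℕ.+ (k ℕ.+ j)) e)
        m+[n∸2k]≡ : m ℕ.+ ((k ℕ.+ j) ℕ.+ (k ℕ.+ j) ℕ.+ e ∸ (k ℕ.+ k)) ≡ (k ℕ.+ j) ℕ.+ (k ℕ.+ j) ℕ.+ e ℕ.+ m ∸ (k ℕ.+ k)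
        m+[n∸2k]≡ = ≡.trans (cong (m ℕ.+_) n∸2k≡) (≡.trans m+[j+j+e]≡ (≡.sym n+m∸2k≡))
          where
          m+[j+j+e]≡ : m ℕ.+ (j ℕ.+ j ℕ.+ e) ≡ j ℕ.+ j ℕ.+ (e ℕ.+ m)
          m+[j+j+e]≡ = ℕ-solve (j ∷ e ∷ m ∷ [])
        n+m≡ : (k ℕ.+ j) ℕ.+ (k ℕ.+ j) ℕ.+ e ℕ.+ m ≡ j ℕ.+ j ℕ.+ (e ℕ.+ m) ℕ.+ k ℕ.+ k
        n+m≡ = ℕ-solve (k ∷ j ∷ e ∷ m ∷ [])

      orthogonality : ∀ n t → t ℕ.+ t ≤ n →
        Σ≤ t (λ k → inverseCoeff n k * lCoeff (n ∸ (k ℕ.+ k)) (t ∸ k)) ≈ iver t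
      orthogonality n zero      _      = *-≈1
        (*-≈1 (*-≈1 refl (x*[1*x]⁻¹≈1 n)) (⁻¹-inverse [ n ℕ.+ m ]! (qfact≉0 (n ℕ.+ m))))
        (*-≈1 (*-≈1 (*-≈1 refl refl) (x*[1*x]⁻¹≈1 n)) 1⁻¹≈1)
        where
        x*[1*x]⁻¹≈1 : ∀ n → [ n ]! * (1# * [ n ]!) ⁻¹ ≈ 1#
        x*[1*x]⁻¹≈1 n = trans (*-congˡ (⁻¹-cong (*-identityˡ [ n ]!))) (⁻¹-inverse [ n ]! (qfact≉0 n))
      orthogonality n t@(suc t′) 2t≤n = *-cancelʳ D D≉0 (begin
        Σ≤ t term * D                                                 ≈⟨ Σ≤-distribʳ t D term ⟩
        Σ≤ t (λ k → term k * D)                                       ≈⟨ Σ≤-cong t (λ k k≤t →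
                                                                           coefficientProduct k (t ∸ k) e (≡.sym (ℕₚ.m+[n∸m]≡n k≤t)) n≡) ⟩
        Σ≤ t (λ k → s ^ t * [ n ]! * orthogonalityTerm M k (t ∸ k))   ≈⟨ Σ≤-distribˡ t _ _ ⟨
        s ^ t * [ n ]! * Σ≤ t (λ k → orthogonalityTerm M k (t ∸ k))   ≈⟨ *-congˡ (orthogonalityTerm-telescopes M t′) ⟩
        s ^ t * [ n ]! * 0#                                           ≈⟨ zeroʳ _ ⟩
        0#                                                            ≈⟨ zeroˡ D ⟨
        0# * D                                                        ∎)
        where
        term : ℕ → Carrier
        term k = inverseCoeff n k * lCoeff (n ∸ (k ℕ.+ k)) (t ∸ k)
        e M : ℕ
        e = n ∸ (t ℕ.+ t)
        M = e ℕ.+ m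
        D : Carrier
        D = [ e ]! * [ t ]! * [ n ℕ.+ m ]!
        D≉0 : D ≉ 0#
        D≉0 = *-≉0 (*-≉0 (qfact≉0 e) (qfact≉0 t)) (qfact≉0 (n ℕ.+ m))
        n≡ : n ≡ t ℕ.+ t ℕ.+ e
        n≡ = ≡.sym (ℕₚ.m+[n∸m]≡n 2t≤n)

      inverseCoeff-diagonal : ∀ N →
        inverseCoeff (N ℕ.+ N) N ≈ (- s) ^ N * ([ N ℕ.+ N ]! * [ m ]!) * ([ N ]! * [ m ℕ.+ N ]!) ⁻¹
      inverseCoeff-diagonal N = at (ℕₚ.n∸n≡0 (N ℕ.+ N)) (ℕₚ.m+n∸m≡n (N ℕ.+ N) m) N+N+m∸N≡m+N
        where
        N+N+m∸N≡m+N : N ℕ.+ N ℕ.+ m ∸ N ≡ m ℕ.+ N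
        N+N+m∸N≡m+N = m≡n+o⇒m∸n≡o N N+N+m≡
          where
          N+N+m≡ : N ℕ.+ N ℕ.+ m ≡ N ℕ.+ (m ℕ.+ N)
          N+N+m≡ = ℕ-solve (N ∷ m ∷ [])
        at : ∀ {p a b} → p ≡ 0 → a ≡ m → b ≡ m ℕ.+ N →
          inverseCoeffAt (N ℕ.+ N) N p a b ≈ (- s) ^ N * ([ N ℕ.+ N ]! * [ m ]!) * ([ N ]! * [ m ℕ.+ N ]!) ⁻¹
        at ≡.refl ≡.refl ≡.refl = begin
          (- s) ^ N * ([ N ℕ.+ N ]! * ([ N ]! * 1#) ⁻¹) * ([ m ]! * [ m ℕ.+ N ]! ⁻¹)
            ≈⟨ *-congʳ (*-congˡ (*-congˡ (⁻¹-cong (*-identityʳ [ N ]!)))) ⟩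
          (- s) ^ N * ([ N ℕ.+ N ]! * [ N ]! ⁻¹) * ([ m ]! * [ m ℕ.+ N ]! ⁻¹)
            ≈⟨ solve 5 (λ x a b c d → x :* (a :* b) :* (c :* d) := x :* (a :* c) :* (b :* d)) refl _ _ _ _ _ ⟩
          (- s) ^ N * ([ N ℕ.+ N ]! * [ m ]!) * ([ N ]! ⁻¹ * [ m ℕ.+ N ]! ⁻¹)
            ≈⟨ *-congˡ (⁻¹-distrib-* (qfact≉0 N) (qfact≉0 (m ℕ.+ N))) ⟨
          (- s) ^ N * ([ N ℕ.+ N ]! * [ m ]!) * ([ N ]! * [ m ℕ.+ N ]!) ⁻¹ ∎

      monomial-inversion : ∀ x n → x ^ n ≈ Σ≤ ⌊ n /2⌋ (λ k → inverseCoeff n k * l (n ∸ (k ℕ.+ k)) x m s q)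
      monomial-inversion x = Σ≤-inversion inverseCoeff lCoeff orthogonality (x ^_)

    module _ (m : ℕ) (Λx : ℕ → Carrier) (Λl≈iver : ∀ n → lExpand m (- (q ^ m)) q Λx n ≈ iver n) where

      Λ-inversion : ∀ n → Λx n ≈ Σ≤ ⌊ n /2⌋ (λ k → inverseCoeff m (- (q ^ m)) n k * iver (n ∸ (k ℕ.+ k)))
      Λ-inversion n = trans (Σ≤-inversion (inverseCoeff m s) (lCoeff m s) (orthogonality m s) Λx n)
                            (Σ≤-cong ⌊ n /2⌋ (λ k _ → *-congˡ (Λl≈iver (n ∸ (k ℕ.+ k)))))
        where
        s : Carrier
        s = - (q ^ m)

      Λ-odd : ∀ N → Λx (suc (N ℕ.+ N)) ≈ 0#
      Λ-odd N = trans (Λ-inversion (suc (N ℕ.+ N))) (Σ≤-iver-odd N _)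

      Λ-even : ∀ N → Λx (N ℕ.+ N) ≈ q ^ (m ℕ.* N) * ([ N ℕ.+ N ]! * [ m ]!) * ([ N ]! * [ m ℕ.+ N ]!) ⁻¹
      Λ-even N = begin
        Λx (N ℕ.+ N)                                                         ≈⟨ Λ-inversion (N ℕ.+ N) ⟩
        Σ≤ ⌊ N ℕ.+ N /2⌋ (λ k → inverseCoeff m (- (q ^ m)) (N ℕ.+ N) k * iver (N ℕ.+ N ∸ (k ℕ.+ k)))
                                                                             ≈⟨ Σ≤-iver-even N _ ⟩
        inverseCoeff m (- (q ^ m)) (N ℕ.+ N) N                               ≈⟨ inverseCoeff-diagonal m (- (q ^ m)) N ⟩
        (- (- (q ^ m))) ^ N * ([ N ℕ.+ N ]! * [ m ]!) * ([ N ]! * [ m ℕ.+ N ]!) ⁻¹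
                                                                             ≈⟨ *-congʳ (*-congʳ (trans (^-congˡ N (-‿involutive (q ^ m))) (^-assocʳ q m N))) ⟩
        q ^ (m ℕ.* N) * ([ N ℕ.+ N ]! * [ m ]!) * ([ N ]! * [ m ℕ.+ N ]!) ⁻¹  ∎

mainTheorem7 : ∀ {c ℓ} (F : Field c ℓ) → let open FieldOps F in
    (q : Carrier) → (∀ j → ¬ (qint q (suc j) ≈ 0#)) → (m : ℕ) →
    ((s x : Carrier) (n : ℕ) →
      x ^ n ≈ Σ≤ ⌊ n /2⌋ (λ k →
        ((- s) ^ k)
        * (qfact q n * ((qfact q k * qfact q (n ∸ (k Data.Nat.+ k))) ⁻¹))
        * (qfact q ((n Data.Nat.+ m) ∸ (k Data.Nat.+ k)) * ((qfact q ((n Data.Nat.+ m) ∸ k)) ⁻¹))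
        * l (n ∸ (k Data.Nat.+ k)) x m s q))
    ×
    ((Λx : ℕ → Carrier) →
      (∀ n → lExpand m (- (q ^ m)) q Λx n ≈ iver n) →
      ∀ n → (Λx (suc (n Data.Nat.+ n)) ≈ 0#)
          × (Λx (n Data.Nat.+ n) ≈ (q ^ (m Data.Nat.* n)) * (qfact q (n Data.Nat.+ n) * qfact q m)
                                    * ((qfact q n * qfact q (m Data.Nat.+ n)) ⁻¹)))
mainTheorem7 F q qint≉0 m =
  (λ s → monomial-inversion F q qint≉0 m s) ,
  (λ Λx Λl≈iver n → Λ-odd F q qint≉0 m Λx Λl≈iver n , Λ-even F q qint≉0 m Λx Λl≈iver n)
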